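{- Let $T'$ be a plane tree on $d$ vertices and $p$ an integer with $2\le p\le d$. Then there is a unique (up to isomorphism of plane trees) plane tree $T$ on $d+1$ vertices such that the vertex $u$ of $T$ with postorder label $p$ is a type $[2]$ special vertex and removing $u$ from $T$ yields $T'$. Furthermore, for each $\tau\in\{0,1,2\}$ and each nonroot vertex $v\ne u$ of $T$ with postorder label at most $p-1$, $v$ is a type $[\tau]$ special vertex in $T$ if and only if it is a type $[\tau]$ special vertex in $T'$.
   Context: A plane tree is a rooted tree whose children at each vertex are linearly ordered left to right; the first is the leftmost child; a leaf has no children. Postorder labeling of a plane tree on $n$ vertices: remove the root, label the subtrees rooted at the root's children, left to right, consecutively and each recursively in postorder, then give the root label $n$. Removal of a nonroot vertex $v$ with parent $w$: delete $v$ and replace $v$ in the ordered list of children of $w$ by the ordered list of children of $v$. Special vertices: type $[0]$: a leaf that is the leftmost child of its parent; type $[1]$: a leaf that is not the leftmost child of its parent; type $[2]$: a non-leaf that is the leftmost child of its parent. -}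

module Defs where

open import Data.Nat using (ℕ; zero; suc; _+_; _≡ᵇ_)
open import Data.List using (List; []; _∷_; _++_)
open import Data.Bool using (Bool; true; false; if_then_else_)
open import Data.Maybe using (Maybe; just; nothing)
open import Relation.Binary.PropositionalEquality using (_≡_)

-- Plane trees: a vertex with an ordered (left-to-right) list of children.
-- Two plane trees are isomorphic iff they are equal as values of this type.
data Tree : Set where
  node : List Tree → Tree

mutual
  size : Tree → ℕ
  size (node cs) = suc (sizes cs)

  sizes : List Tree → ℕ
  sizes []       = 0
  sizes (c ∷ cs) = size c + sizes cs

data LTree : Set where
  lnode : ℕ → List LTree → LTree

mutual
  erase : LTree → Tree
  erase (lnode _ cs) = node (eraseList cs)

  eraseList : List LTree → List Tree
  eraseList []       = []
  eraseList (c ∷ cs) = erase c ∷ eraseList cs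

mutual
  -- postorder labelling with labels off+1, …, off+size t
  -- (children subtrees labelled left to right consecutively, root last)
  labelFrom : ℕ → Tree → LTree
  labelFrom off (node cs) = lnode (off + size (node cs)) (labelListFrom off cs)

  labelListFrom : ℕ → List Tree → List LTree
  labelListFrom off []       = []
  labelListFrom off (c ∷ cs) = labelFrom off c ∷ labelListFrom (off + size c) cs

postorder : Tree → LTree
postorder = labelFrom 0

-- Names of the remaining vertices are kept, so they identify the
-- vertices of the resulting tree with those of the original one.
mutual
  removeV : ℕ → LTree → LTree
  removeV p (lnode r cs) = lnode r (removeList p cs)

  removeList : ℕ → List LTree → List LTree
  removeList p []                = []
  removeList p (lnode q ds ∷ cs) =
    if q ≡ᵇ p then removeList p ds ++ removeList p cs
              else lnode q (removeList p ds) ∷ removeList p cs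

data SpecialType : Set where
  [0] [1] [2] : SpecialType

-- kind of a nonroot vertex, given whether it is the leftmost child of its
-- parent and its list of children
kind : Bool → List LTree → Maybe SpecialType
kind true  []      = just [0]
kind false []      = just [1]
kind true  (_ ∷ _) = just [2]
kind false (_ ∷ _) = nothing

mutual
  data Special (τ : SpecialType) (q : ℕ) : LTree → Set where
    inChildren : ∀ {r cs} → SpecialList τ q true cs → Special τ q (lnode r cs)

  -- SpecialList τ q b cs : in the child list cs (whose first element is
  -- leftmost iff b), the vertex named q is special of type τ
  data SpecialList (τ : SpecialType) (q : ℕ) : Bool → List LTree → Set where
    here  : ∀ {b ds rest} → kind b ds ≡ just τ →
            SpecialList τ q b (lnode q ds ∷ rest)
    below : ∀ {b t rest} → Special τ q t → SpecialList τ q b (t ∷ rest)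
    later : ∀ {b t rest} → SpecialList τ q false rest → SpecialList τ q b (t ∷ rest)

module Submission where

-- Inserting a type-[2] vertex with postorder label p into a tree T′ is
-- forced.  Among the children of a vertex whose subtree is to receive the new
-- vertex, the children are passed from left to right while counting labels:
-- if the labels of some prefix of children end exactly at p - 1, the new
-- vertex becomes the leftmost child and adopts that prefix; otherwise label
-- p - 1 lies strictly inside the subtree of one child, and the insertion
-- descends into it.

open import Defs
open import Data.Nat using (ℕ; suc; _≤_; _∸_)
open import Data.Product using (Σ; _×_)
open import Function.Bundles using (_⇔_)
open import Relation.Binary.PropositionalEquality using (_≡_)

open import Data.Nat using (_+_; _<_; _≡ᵇ_; z≤n; s≤s; s≤s⁻¹)
open import Data.Nat.Properties
open import Data.List using (List; []; _∷_; _++_)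
open import Data.List.Properties using (++-assoc)
open import Data.Bool using (true; false)
open import Data.Maybe using (just)
open import Data.Product using (_,_; proj₁; proj₂; ∃)
open import Data.Sum using (_⊎_; inj₁; inj₂)
open import Data.Empty using (⊥-elim)
open import Data.Unit using (tt)
open import Relation.Nullary using (¬_)
open import Relation.Binary.Definitions using (tri<; tri≈; tri>)
open import Relation.Binary.PropositionalEquality
  using (refl; sym; trans; cong; cong₂; subst; _≢_; module ≡-Reasoning)
open import Function.Bundles using (mk⇔; module Equivalence)

open ≡-Reasoning

removeList-hit : ∀ {p q} ds cs → q ≡ p →
                 removeList p (lnode q ds ∷ cs) ≡ removeList p ds ++ removeList p cs
removeList-hit {p} {q} _ _ q≡p with q ≡ᵇ p | ≡⇒≡ᵇ q p q≡p
... | true | _ = refl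

removeList-miss : ∀ {p q} ds cs → q ≢ p →
                  removeList p (lnode q ds ∷ cs) ≡ lnode q (removeList p ds) ∷ removeList p cs
removeList-miss {p} {q} _ _ q≢p with q ≡ᵇ p | ≡ᵇ⇒≡ q p
... | false | _        = refl
... | true  | to-equal = ⊥-elim (q≢p (to-equal tt))

sizes-++ : ∀ xs ys → sizes (xs ++ ys) ≡ sizes xs + sizes ys
sizes-++ []       ys = refl
sizes-++ (x ∷ xs) ys = trans (cong (size x +_) (sizes-++ xs ys)) (sym (+-assoc (size x) _ _))

eraseList-++ : ∀ xs ys → eraseList (xs ++ ys) ≡ eraseList xs ++ eraseList ys
eraseList-++ []       ys = refl
eraseList-++ (x ∷ xs) ys = cong (erase x ∷_) (eraseList-++ xs ys)

removeList-++ : ∀ p xs ys → removeList p (xs ++ ys) ≡ removeList p xs ++ removeList p ys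
removeList-++ p []                ys = refl
removeList-++ p (lnode q ds ∷ xs) ys with q ≡ᵇ p
... | true  = trans (cong (removeList p ds ++_) (removeList-++ p xs ys))
                    (sym (++-assoc (removeList p ds) _ _))
... | false = cong (lnode q (removeList p ds) ∷_) (removeList-++ p xs ys)

labels-split : ∀ o xs ys {o′} → o + sizes xs ≡ o′ →
               labelListFrom o (xs ++ ys) ≡ labelListFrom o xs ++ labelListFrom o′ ys
labels-split o []       ys end = cong (λ k → labelListFrom k ys) (trans (sym (+-identityʳ o)) end)
labels-split o (x ∷ xs) ys end =
  cong (labelFrom o x ∷_) (labels-split (o + size x) xs ys (trans (+-assoc o _ _) end))

mutual
  erase-label : ∀ o t → erase (labelFrom o t) ≡ t
  erase-label o (node cs) = cong node (erase-labels o cs)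

  erase-labels : ∀ o cs → eraseList (labelListFrom o cs) ≡ cs
  erase-labels o []       = refl
  erase-labels o (c ∷ cs) = cong₂ _∷_ (erase-label o c) (erase-labels (o + size c) cs)

mutual
  special-range : ∀ {τ q} o t → Special τ q (labelFrom o t) → o < q × q < o + size t
  special-range o (node ds) (inChildren s) with specials-range o ds s
  ... | o<q , q≤end = o<q , ≤-trans (s≤s q≤end) (≤-reflexive (sym (+-suc o (sizes ds))))

  specials-range : ∀ {τ q b} o cs → SpecialList τ q b (labelListFrom o cs) →
                   o < q × q ≤ o + sizes cs
  specials-range o (node es ∷ cs) (here _) =
    m<m+n o (s≤s z≤n) , +-monoʳ-≤ o (m≤m+n (size (node es)) (sizes cs))
  specials-range o (node es ∷ cs) (below s) with special-range o (node es) s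
  ... | o<q , q<end = o<q , ≤-trans (<⇒≤ q<end) (+-monoʳ-≤ o (m≤m+n _ _))
  specials-range o (node es ∷ cs) (later s) with specials-range (o + size (node es)) cs s
  ... | start<q , q≤end =
    ≤-<-trans (m≤m+n o _) start<q , ≤-trans q≤end (≤-reflexive (+-assoc o _ _))

kind-[2]-leftmost : ∀ {b ds} → kind b ds ≡ just [2] → b ≡ true
kind-[2]-leftmost {true}            _  = refl
kind-[2]-leftmost {false} {[]}      ()
kind-[2]-leftmost {false} {_ ∷ _}   ()

leaf-not-[2] : ∀ {b} → ¬ kind b [] ≡ just [2]
leaf-not-[2] {true}  ()
leaf-not-[2] {false} ()

kind-leftmost-or-leaf : ∀ {b ds τ} → kind b ds ≡ just τ → b ≡ true ⊎ ds ≡ []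
kind-leftmost-or-leaf {true}          _  = inj₁ refl
kind-leftmost-or-leaf {false} {[]}    _  = inj₂ refl
kind-leftmost-or-leaf {false} {_ ∷ _} ()

-- A type-[2] vertex has a descendant, so its label is at least o + 2.
label-after-two : ∀ o n → suc o < o + suc (suc n)
label-after-two o n =
  ≤-trans (s≤s (s≤s (m≤m+n o n))) (≤-reflexive (sym (trans (+-suc o _) (cong suc (+-suc o n)))))

mutual
  type2-lower : ∀ {q} o t → Special [2] q (labelFrom o t) → suc o < q
  type2-lower o (node ds) (inChildren s) = types2-lower o ds s

  types2-lower : ∀ {q b} o cs → SpecialList [2] q b (labelListFrom o cs) → suc o < q
  types2-lower o (node []             ∷ cs) (here k)  = ⊥-elim (leaf-not-[2] k)
  types2-lower o (node (node fs ∷ es) ∷ cs) (here _)  =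
    label-after-two o (sizes fs + sizes es)
  types2-lower o (node es ∷ cs) (below s) = type2-lower o (node es) s
  types2-lower o (node es ∷ cs) (later s) =
    ≤-<-trans (s≤s (m≤m+n o _)) (types2-lower (o + size (node es)) cs s)

Outside : ℕ → ℕ → ℕ → Set
Outside p o n = p ≤ o ⊎ o + n < p

outside-≤ : ∀ {p o m n} → m ≤ n → Outside p o n → Outside p o m
outside-≤ _   (inj₁ p≤o) = inj₁ p≤o
outside-≤ m≤n (inj₂ end<p) = inj₂ (≤-<-trans (+-monoʳ-≤ _ m≤n) end<p)

outside-shift : ∀ {p o} m n → Outside p o (m + n) → Outside p (o + m) n
outside-shift {o = o} m n (inj₁ p≤o)   = inj₁ (≤-trans p≤o (m≤m+n o m))
outside-shift {o = o} m n (inj₂ end<p) = inj₂ (≤-<-trans (≤-reflexive (+-assoc o m n)) end<p)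

outside-last : ∀ {p o} n → Outside p o (suc n) → o + suc n ≢ p
outside-last {o = o} n (inj₁ p≤o) refl = <-irrefl refl (<-≤-trans (m<m+n o (s≤s z≤n)) p≤o)
outside-last         n (inj₂ end<p) e  = <-irrefl e end<p

remove-absent : ∀ p o cs → Outside p o (sizes cs) →
                removeList p (labelListFrom o cs) ≡ labelListFrom o cs
remove-absent p o []             _   = refl
remove-absent p o (node es ∷ cs) out =
  trans (removeList-miss (labelListFrom o es) (labelListFrom (o + size (node es)) cs)
                         (outside-last (sizes es) (outside-≤ (m≤m+n _ (sizes cs)) out)))
        (cong₂ (λ X Y → lnode (o + size (node es)) X ∷ Y)
               (remove-absent p o es (outside-≤ (≤-trans (n≤1+n _) (m≤m+n _ _)) out))
               (remove-absent p (o + size (node es)) cs (outside-shift _ _ out)))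

remove-first : ∀ p o es cs → o + size (node es) ≡ p →
               removeList p (labelListFrom o (node es ∷ cs))
               ≡ labelListFrom o es ++ labelListFrom (o + size (node es)) cs
remove-first p o es cs root≡p =
  trans (removeList-hit (labelListFrom o es) (labelListFrom (o + size (node es)) cs) root≡p)
        (cong₂ _++_ (remove-absent p o es (inj₂ (subst (o + sizes es <_) root≡p (+-monoʳ-< o (n<1+n _)))))
                    (remove-absent p _ cs (inj₁ (≤-reflexive (sym root≡p)))))

remove-inside-first : ∀ p o t cs → p < o + size t →
                      removeList p (labelListFrom o (t ∷ cs))
                      ≡ removeV p (labelFrom o t) ∷ labelListFrom (o + size t) cs
remove-inside-first p o (node es) cs p<root =
  trans (removeList-miss (labelListFrom o es) (labelListFrom (o + size (node es)) cs)
                         (λ root≡p → <-irrefl (sym root≡p) p<root))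
        (cong (removeV p (labelFrom o (node es)) ∷_) (remove-absent p _ cs (inj₁ (<⇒≤ p<root))))

remove-after-first : ∀ p o es cs → o + size (node es) < p →
                     removeList p (labelListFrom o (node es ∷ cs))
                     ≡ labelFrom o (node es) ∷ removeList p (labelListFrom (o + size (node es)) cs)
remove-after-first p o es cs root<p =
  trans (removeList-miss (labelListFrom o es) (labelListFrom (o + size (node es)) cs) (<⇒≢ root<p))
        (cong (λ X → lnode (o + size (node es)) X ∷ removeList p (labelListFrom (o + size (node es)) cs))
              (remove-absent p o es (inj₂ (<-trans (+-monoʳ-< o (n<1+n _)) root<p))))

erase-remove-first : ∀ p o es cs → o + size (node es) ≡ p →
                     eraseList (removeList p (labelListFrom o (node es ∷ cs))) ≡ es ++ cs
erase-remove-first p o es cs root≡p = begin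
  eraseList (removeList p (labelListFrom o (node es ∷ cs)))
    ≡⟨ cong eraseList (remove-first p o es cs root≡p) ⟩
  eraseList (labelListFrom o es ++ labelListFrom _ cs)
    ≡⟨ eraseList-++ (labelListFrom o es) _ ⟩
  eraseList (labelListFrom o es) ++ eraseList (labelListFrom _ cs)
    ≡⟨ cong₂ _++_ (erase-labels o es) (erase-labels _ cs) ⟩
  es ++ cs ∎

erase-remove-inside-first : ∀ p o t cs → p < o + size t →
                            eraseList (removeList p (labelListFrom o (t ∷ cs)))
                            ≡ erase (removeV p (labelFrom o t)) ∷ cs
erase-remove-inside-first p o t cs p<root =
  trans (cong eraseList (remove-inside-first p o t cs p<root)) (cong (_ ∷_) (erase-labels _ cs))

erase-remove-after-first : ∀ p o es cs → o + size (node es) < p →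
                           eraseList (removeList p (labelListFrom o (node es ∷ cs)))
                           ≡ node es ∷ eraseList (removeList p (labelListFrom (o + size (node es)) cs))
erase-remove-after-first p o es cs root<p =
  trans (cong eraseList (remove-after-first p o es cs root<p))
        (cong (_∷ eraseList (removeList p (labelListFrom (o + size (node es)) cs))) (erase-label o (node es)))

erase-remove-beyond : ∀ p o₀ pre cs {o} → o₀ + sizes pre ≡ o → o < p →
                      eraseList (removeList p (labelListFrom o₀ (pre ++ cs)))
                      ≡ pre ++ eraseList (removeList p (labelListFrom o cs))
erase-remove-beyond p o₀ pre cs end o<p = begin
  eraseList (removeList p (labelListFrom o₀ (pre ++ cs)))
    ≡⟨ cong (λ L → eraseList (removeList p L)) (labels-split o₀ pre cs end) ⟩
  eraseList (removeList p (labelListFrom o₀ pre ++ labelListFrom _ cs))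
    ≡⟨ cong eraseList (removeList-++ p (labelListFrom o₀ pre) _) ⟩
  eraseList (removeList p (labelListFrom o₀ pre) ++ removeList p (labelListFrom _ cs))
    ≡⟨ cong (λ X → eraseList (X ++ _)) (remove-absent p o₀ pre (inj₂ (subst (_< p) (sym end) o<p))) ⟩
  eraseList (labelListFrom o₀ pre ++ removeList p (labelListFrom _ cs))
    ≡⟨ eraseList-++ (labelListFrom o₀ pre) _ ⟩
  eraseList (labelListFrom o₀ pre) ++ eraseList (removeList p (labelListFrom _ cs))
    ≡⟨ cong (_++ _) (erase-labels o₀ pre) ⟩
  pre ++ eraseList (removeList p (labelListFrom _ cs)) ∎

mutual
  size-remove : ∀ {τ p} o t → Special τ p (labelFrom o t) →
                suc (size (erase (removeV p (labelFrom o t)))) ≡ size t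
  size-remove o (node ds) (inChildren s) = cong suc (sizes-remove o ds s)

  sizes-remove : ∀ {τ p b} o cs → SpecialList τ p b (labelListFrom o cs) →
                 suc (sizes (eraseList (removeList p (labelListFrom o cs)))) ≡ sizes cs
  sizes-remove o (node es ∷ cs) (here _) =
    cong suc (trans (cong sizes (erase-remove-first _ o es cs refl)) (sizes-++ es cs))
  sizes-remove {p = p} o (node es ∷ cs) (below s) = begin
    suc (sizes (eraseList (removeList p (labelListFrom o (node es ∷ cs)))))
      ≡⟨ cong (λ L → suc (sizes L))
              (erase-remove-inside-first p o (node es) cs (proj₂ (special-range o (node es) s))) ⟩
    suc (size (erase (removeV p (labelFrom o (node es)))) + sizes cs)
      ≡⟨ cong (_+ sizes cs) (size-remove o (node es) s) ⟩
    size (node es) + sizes cs ∎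
  sizes-remove {p = p} o (node es ∷ cs) (later s) = begin
    suc (sizes (eraseList (removeList p (labelListFrom o (node es ∷ cs)))))
      ≡⟨ cong (λ L → suc (sizes L)) (erase-remove-after-first p o es cs (proj₁ (specials-range _ cs s))) ⟩
    suc (size (node es) + sizes (eraseList (removeList p (labelListFrom _ cs))))
      ≡⟨ sym (+-suc (size (node es)) _) ⟩
    size (node es) + suc (sizes (eraseList (removeList p (labelListFrom _ cs))))
      ≡⟨ cong (size (node es) +_) (sizes-remove _ cs s) ⟩
    size (node es) + sizes cs ∎

first-child-iff : ∀ {τ q b r X X′ R} → r ≢ q →
                  Special τ q (lnode r X) ⇔ Special τ q (lnode r X′) →
                  SpecialList τ q b (lnode r X ∷ R) ⇔ SpecialList τ q b (lnode r X′ ∷ R)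
first-child-iff {τ} {q} {b} {r} {R = R} r≢q subtree = mk⇔ (move to) (move from)
  where
    open Equivalence subtree
    move : ∀ {Y Y′} → (Special τ q (lnode r Y) → Special τ q (lnode r Y′)) →
           SpecialList τ q b (lnode r Y ∷ R) → SpecialList τ q b (lnode r Y′ ∷ R)
    move f (here _)  = ⊥-elim (r≢q refl)
    move f (below s) = below (f s)
    move f (later s) = later s

later-children-iff : ∀ {τ q b x R R′} → SpecialList τ q false R ⇔ SpecialList τ q false R′ →
                     SpecialList τ q b (x ∷ R) ⇔ SpecialList τ q b (x ∷ R′)
later-children-iff {τ} {q} {b} {x} rest = mk⇔ (move to) (move from)
  where
    open Equivalence rest
    move : ∀ {Y Y′} → (SpecialList τ q false Y → SpecialList τ q false Y′) →
           SpecialList τ q b (x ∷ Y) → SpecialList τ q b (x ∷ Y′)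
    move f (here k)  = here k
    move f (below s) = below s
    move f (later s) = later (f s)

specials-++ˡ : ∀ {τ q b X} R → SpecialList τ q b X → SpecialList τ q b (X ++ R)
specials-++ˡ R (here k)  = here k
specials-++ˡ R (below s) = below s
specials-++ˡ R (later s) = later (specials-++ˡ R s)

specials-split : ∀ {τ q b} X {R} → SpecialList τ q b (X ++ R) →
                 SpecialList τ q b X ⊎ ∃ (λ b′ → SpecialList τ q b′ R)
specials-split []      s         = inj₂ (_ , s)
specials-split (x ∷ X) (here k)  = inj₁ (here k)
specials-split (x ∷ X) (below s) = inj₁ (below s)
specials-split (x ∷ X) (later s) with specials-split X s
... | inj₁ s′ = inj₁ (later s′)
... | inj₂ r  = inj₂ r

adopt-iff : ∀ {τ q b r E R} → b ≡ true ⊎ E ≡ [] → r ≢ q →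
            (∀ {b′} → ¬ SpecialList τ q b′ R) →
            SpecialList τ q b (lnode r E ∷ R) ⇔ SpecialList τ q b (E ++ R)
adopt-iff {τ} {q} {r = r} {E} {R} (inj₁ refl) r≢q not-in-R = mk⇔ to from
  where
    to : SpecialList τ q true (lnode r E ∷ R) → SpecialList τ q true (E ++ R)
    to (here _)               = ⊥-elim (r≢q refl)
    to (below (inChildren s)) = specials-++ˡ R s
    to (later s)              = ⊥-elim (not-in-R s)

    from : SpecialList τ q true (E ++ R) → SpecialList τ q true (lnode r E ∷ R)
    from s with specials-split E s
    ... | inj₁ s′      = below (inChildren s′)
    ... | inj₂ (_ , s′) = ⊥-elim (not-in-R s′)
adopt-iff {τ} {q} {b} {r} {R = R} (inj₂ refl) r≢q not-in-R = mk⇔ to (λ s → ⊥-elim (not-in-R s))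
  where
    to : SpecialList τ q b (lnode r [] ∷ R) → SpecialList τ q b R
    to (here _)                = ⊥-elim (r≢q refl)
    to (below (inChildren ()))
    to (later s)               = ⊥-elim (not-in-R s)

children-iff : ∀ {τ q r X Y} → SpecialList τ q true X ⇔ SpecialList τ q true Y →
               Special τ q (lnode r X) ⇔ Special τ q (lnode r Y)
children-iff children =
  mk⇔ (λ { (inChildren s) → inChildren (Equivalence.to   children s) })
      (λ { (inChildren s) → inChildren (Equivalence.from children s) })

rhs-≡ : ∀ {A : Set} {τ q b L L′} → L ≡ L′ →
        A ⇔ SpecialList τ q b L′ → A ⇔ SpecialList τ q b L
rhs-≡ refl equiv = equiv

-- Removing a special vertex p does not change the type of any vertex q < p:
-- every such vertex keeps its name, and only the children of p change their
-- parent, the first of them taking over p's role as leftmost child.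
mutual
  remove-preserves : ∀ {τ τ′ p q} o t → Special τ′ p (labelFrom o t) → q < p →
                     Special τ q (labelFrom o t) ⇔ Special τ q (removeV p (labelFrom o t))
  remove-preserves o (node ds) (inChildren s) q<p = children-iff (removes-preserve o ds s q<p)

  removes-preserve : ∀ {τ τ′ p q b} o cs → SpecialList τ′ p b (labelListFrom o cs) → q < p →
                     SpecialList τ q b (labelListFrom o cs)
                     ⇔ SpecialList τ q b (removeList p (labelListFrom o cs))
  removes-preserve o (node es ∷ cs) (here k) q<p =
    rhs-≡ (remove-first _ o es cs refl)
          (adopt-iff (kind-leftmost-or-leaf k) (λ p≡q → <-irrefl (sym p≡q) q<p)
                     (λ s → <-asym q<p (proj₁ (specials-range _ cs s))))
  removes-preserve {p = p} o (node es ∷ cs) (below s) q<p =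
    rhs-≡ (remove-inside-first p o (node es) cs p<root)
          (first-child-iff (λ root≡q → <-asym q<p (subst (p <_) root≡q p<root))
                           (remove-preserves o (node es) s q<p))
    where
      p<root : p < o + size (node es)
      p<root = proj₂ (special-range o (node es) s)
  removes-preserve {p = p} o (node es ∷ cs) (later s) q<p =
    rhs-≡ (remove-after-first p o es cs (proj₁ (specials-range _ cs s)))
          (later-children-iff (removes-preserve _ cs s q<p))

-- insert p o t inserts a type-[2] vertex which receives label p when the
-- result is labelled from o (meaningful for o + 1 < p ≤ o + size t).
-- insertChildren p o pre cs does the same for a child list: the children pre
-- have already been passed, and cs is labelled from o + 1 on.
mutual
  insert : ℕ → ℕ → Tree → Tree
  insert p o (node ds) = node (insertChildren p o [] ds)

  insertChildren : ℕ → ℕ → List Tree → List Tree → List Tree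
  insertChildren p o pre []       = pre
  insertChildren p o pre (c ∷ cs) with <-cmp (suc (o + size c)) p
  ... | tri< _ _ _ = insertChildren p (o + size c) (pre ++ c ∷ []) cs
  ... | tri≈ _ _ _ = node (pre ++ c ∷ []) ∷ cs
  ... | tri> _ _ _ = pre ++ insert p o c ∷ cs

insertChildren-< : ∀ p o pre c cs → suc (o + size c) < p →
                   insertChildren p o pre (c ∷ cs) ≡ insertChildren p (o + size c) (pre ++ c ∷ []) cs
insertChildren-< p o pre c cs before with <-cmp (suc (o + size c)) p
... | tri< _ _ _    = refl
... | tri≈ _ ends _ = ⊥-elim (<⇒≢ before ends)
... | tri> _ _ past = ⊥-elim (<-asym before past)

insertChildren-≡ : ∀ p o pre c cs → suc (o + size c) ≡ p →
                   insertChildren p o pre (c ∷ cs) ≡ node (pre ++ c ∷ []) ∷ cs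
insertChildren-≡ p o pre c cs ends with <-cmp (suc (o + size c)) p
... | tri< before _ _ = ⊥-elim (<⇒≢ before ends)
... | tri≈ _ _ _      = refl
... | tri> _ _ past   = ⊥-elim (<⇒≢ past (sym ends))

insertChildren-> : ∀ p o pre c cs → p < suc (o + size c) →
                   insertChildren p o pre (c ∷ cs) ≡ pre ++ insert p o c ∷ cs
insertChildren-> p o pre c cs inside with <-cmp (suc (o + size c)) p
... | tri< before _ _ = ⊥-elim (<-asym before inside)
... | tri≈ _ ends _   = ⊥-elim (<⇒≢ inside (sym ends))
... | tri> _ _ _      = refl

adopt-prefix : ∀ p o pre x xs rs → suc (o + sizes (x ∷ xs)) ≡ p →
               insertChildren p o pre (x ∷ xs ++ rs) ≡ node (pre ++ x ∷ xs) ∷ rs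
adopt-prefix p o pre x [] rs ends =
  insertChildren-≡ p o pre x rs (trans (cong (λ n → suc (o + n)) (sym (+-identityʳ (size x)))) ends)
adopt-prefix p o pre x (node fs ∷ xs) rs ends = begin
  insertChildren p o pre (x ∷ node fs ∷ xs ++ rs)
    ≡⟨ insertChildren-< p o pre x _ x-before ⟩
  insertChildren p (o + size x) (pre ++ x ∷ []) (node fs ∷ xs ++ rs)
    ≡⟨ adopt-prefix p (o + size x) (pre ++ x ∷ []) (node fs) xs rs (trans (cong suc (+-assoc o _ _)) ends) ⟩
  node ((pre ++ x ∷ []) ++ node fs ∷ xs) ∷ rs
    ≡⟨ cong (λ Z → node Z ∷ rs) (++-assoc pre (x ∷ []) (node fs ∷ xs)) ⟩
  node (pre ++ x ∷ node fs ∷ xs) ∷ rs ∎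
  where
    x-before : suc (o + size x) < p
    x-before = subst (suc (o + size x) <_) ends (s≤s (+-monoʳ-< o (m<m+n (size x) (s≤s z≤n))))

-- The flag b of the child list tells
-- whether it starts at the leftmost position, in which case nothing has been
-- passed yet.
mutual
  insert-remove : ∀ p o t → Special [2] p (labelFrom o t) →
                  insert p o (erase (removeV p (labelFrom o t))) ≡ t
  insert-remove p o (node ds) (inChildren s) =
    cong node (insertChildren-remove p o [] ds s (λ _ → refl))

  insertChildren-remove : ∀ p o pre cs {b} → SpecialList [2] p b (labelListFrom o cs) →
                          (b ≡ true → pre ≡ []) →
                          insertChildren p o pre (eraseList (removeList p (labelListFrom o cs))) ≡ pre ++ cs
  insertChildren-remove p o pre (node [] ∷ cs) (here k) _ = ⊥-elim (leaf-not-[2] k)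
  insertChildren-remove p o pre (node (x ∷ xs) ∷ cs) (here k) leftmost
    with leftmost (kind-[2]-leftmost k)
  ... | refl = begin
    insertChildren p o [] (eraseList (removeList p (labelListFrom o (node (x ∷ xs) ∷ cs))))
      ≡⟨ cong (insertChildren p o []) (erase-remove-first p o (x ∷ xs) cs refl) ⟩
    insertChildren p o [] (x ∷ xs ++ cs)
      ≡⟨ adopt-prefix p o [] x xs cs (sym (+-suc o _)) ⟩
    node (x ∷ xs) ∷ cs ∎
  insertChildren-remove p o pre (node es ∷ cs) (below s) _ = begin
    insertChildren p o pre (eraseList (removeList p (labelListFrom o (node es ∷ cs))))
      ≡⟨ cong (insertChildren p o pre) (erase-remove-inside-first p o (node es) cs p<root) ⟩
    insertChildren p o pre (E ∷ cs)
      ≡⟨ insertChildren-> p o pre E cs p<end ⟩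
    pre ++ insert p o E ∷ cs
      ≡⟨ cong (λ t → pre ++ t ∷ cs) (insert-remove p o (node es) s) ⟩
    pre ++ node es ∷ cs ∎
    where
      E : Tree
      E = erase (removeV p (labelFrom o (node es)))
      p<root : p < o + size (node es)
      p<root = proj₂ (special-range o (node es) s)
      p<end : p < suc (o + size E)
      p<end = subst (p <_) (trans (cong (o +_) (sym (size-remove o (node es) s))) (+-suc o _)) p<root
  insertChildren-remove p o pre (node es ∷ cs) (later s) _ = begin
    insertChildren p o pre (eraseList (removeList p (labelListFrom o (node es ∷ cs))))
      ≡⟨ cong (insertChildren p o pre) (erase-remove-after-first p o es cs (<-trans (n<1+n _) next<p)) ⟩
    insertChildren p o pre (node es ∷ eraseList (removeList p (labelListFrom o′ cs)))
      ≡⟨ insertChildren-< p o pre (node es) _ next<p ⟩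
    insertChildren p o′ (pre ++ node es ∷ []) (eraseList (removeList p (labelListFrom o′ cs)))
      ≡⟨ insertChildren-remove p o′ (pre ++ node es ∷ []) cs s (λ ()) ⟩
    (pre ++ node es ∷ []) ++ cs
      ≡⟨ ++-assoc pre _ cs ⟩
    pre ++ node es ∷ cs ∎
    where
      o′ : ℕ
      o′ = o + size (node es)
      next<p : suc o′ < p
      next<p = types2-lower o′ cs s

-- Bookkeeping for the existence proofs: o is where the labels of cs start when
-- the passed children pre are labelled from o₀, and p must fall after o + 1
-- and no later than the label o + sizes cs + 1 of the new vertex.
passed-one : ∀ o₀ pre c {o} → o₀ + sizes pre ≡ o → o₀ + sizes (pre ++ c ∷ []) ≡ o + size c
passed-one o₀ pre c {o} passed = begin
  o₀ + sizes (pre ++ c ∷ [])       ≡⟨ cong (o₀ +_) (sizes-++ pre (c ∷ [])) ⟩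
  o₀ + (sizes pre + (size c + 0))  ≡⟨ cong (λ n → o₀ + (sizes pre + n)) (+-identityʳ (size c)) ⟩
  o₀ + (sizes pre + size c)        ≡⟨ sym (+-assoc o₀ _ _) ⟩
  o₀ + sizes pre + size c          ≡⟨ cong (_+ size c) passed ⟩
  o + size c                       ∎

no-room : ∀ {p o} → suc o < p → ¬ p ≤ suc (o + sizes [])
no-room {o = o} o+1<p p≤o+1 =
  <-irrefl refl (<-≤-trans o+1<p (≤-trans p≤o+1 (≤-reflexive (cong suc (+-identityʳ o)))))

room-after : ∀ {p} o c cs → p ≤ suc (o + sizes (c ∷ cs)) → p ≤ suc (o + size c + sizes cs)
room-after o c cs p≤end = ≤-trans p≤end (≤-reflexive (cong suc (sym (+-assoc o _ _))))

room-below-root : ∀ {p} o ds → p ≤ o + size (node ds) → p ≤ suc (o + sizes ds)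
room-below-root o ds p≤root = ≤-trans p≤root (≤-reflexive (+-suc o _))

adopter-label : ∀ {p} o₀ pre c {o} → o₀ + sizes pre ≡ o → suc (o + size c) ≡ p →
                o₀ + size (node (pre ++ c ∷ [])) ≡ p
adopter-label o₀ pre c passed ends =
  trans (+-suc o₀ _) (trans (cong suc (passed-one o₀ pre c passed)) ends)

adopter-is-[2] : ∀ o pre c → kind true (labelListFrom o (pre ++ c ∷ [])) ≡ just [2]
adopter-is-[2] o []      c = refl
adopter-is-[2] o (_ ∷ _) c = refl

here-named : ∀ {τ q b r ds rest} → r ≡ q → kind b ds ≡ just τ →
             SpecialList τ q b (lnode r ds ∷ rest)
here-named refl k = here k

special-inside : ∀ {τ q b} A {x B} → Special τ q x → SpecialList τ q b (A ++ x ∷ B)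
special-inside []      s = below s
special-inside (a ∷ A) s = later (special-inside A s)

mutual
  insert-special : ∀ p o t → suc o < p → p ≤ o + size t →
                   Special [2] p (labelFrom o (insert p o t))
  insert-special p o (node ds) o+1<p p≤root =
    inChildren (insertChildren-special p o [] ds (+-identityʳ o) o+1<p (room-below-root o ds p≤root))

  insertChildren-special : ∀ p o₀ pre cs {o} → o₀ + sizes pre ≡ o →
                           suc o < p → p ≤ suc (o + sizes cs) →
                           SpecialList [2] p true (labelListFrom o₀ (insertChildren p o pre cs))
  insertChildren-special p o₀ pre []       _      o+1<p p≤end = ⊥-elim (no-room o+1<p p≤end)
  insertChildren-special p o₀ pre (c ∷ cs) {o} passed o+1<p p≤end with <-cmp (suc (o + size c)) p
  ... | tri< before _ _ =
    insertChildren-special p o₀ (pre ++ c ∷ []) cs (passed-one o₀ pre c passed) before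
                           (room-after o c cs p≤end)
  ... | tri≈ _ ends _ = here-named (adopter-label o₀ pre c passed ends) (adopter-is-[2] o₀ pre c)
  ... | tri> _ _ inside =
    subst (SpecialList [2] p true) (sym (labels-split o₀ pre (insert p o c ∷ cs) passed))
          (special-inside (labelListFrom o₀ pre) (insert-special p o c o+1<p (s≤s⁻¹ inside)))

mutual
  remove-insert : ∀ p o t → suc o < p → p ≤ o + size t →
                  erase (removeV p (labelFrom o (insert p o t))) ≡ t
  remove-insert p o (node ds) o+1<p p≤root =
    cong node (removeChildren-insert p o [] ds (+-identityʳ o) o+1<p (room-below-root o ds p≤root))

  removeChildren-insert : ∀ p o₀ pre cs {o} → o₀ + sizes pre ≡ o →
                          suc o < p → p ≤ suc (o + sizes cs) →
                          eraseList (removeList p (labelListFrom o₀ (insertChildren p o pre cs))) ≡ pre ++ cs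
  removeChildren-insert p o₀ pre [] _ o+1<p p≤end = ⊥-elim (no-room o+1<p p≤end)
  removeChildren-insert p o₀ pre (c ∷ cs) {o} passed o+1<p p≤end
    with <-cmp (suc (o + size c)) p
  ... | tri< before _ _ =
    trans (removeChildren-insert p o₀ (pre ++ c ∷ []) cs (passed-one o₀ pre c passed) before
                                 (room-after o c cs p≤end))
          (++-assoc pre _ cs)
  ... | tri≈ _ ends _ =
    trans (erase-remove-first p o₀ (pre ++ c ∷ []) cs (adopter-label o₀ pre c passed ends))
          (++-assoc pre _ cs)
  ... | tri> _ _ inside = begin
    eraseList (removeList p (labelListFrom o₀ (pre ++ I ∷ cs)))
      ≡⟨ erase-remove-beyond p o₀ pre (I ∷ cs) passed (<-trans (n<1+n o) o+1<p) ⟩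
    pre ++ eraseList (removeList p (labelListFrom o (I ∷ cs)))
      ≡⟨ cong (pre ++_) (erase-remove-inside-first p o I cs p<root) ⟩
    pre ++ erase (removeV p (labelFrom o I)) ∷ cs
      ≡⟨ cong (λ t → pre ++ t ∷ cs) (remove-insert p o c o+1<p (s≤s⁻¹ inside)) ⟩
    pre ++ c ∷ cs ∎
    where
      I : Tree
      I = insert p o c
      p<root : p < o + size I
      p<root = proj₂ (special-range o I (insert-special p o c o+1<p (s≤s⁻¹ inside)))

lemma3p10 : (d : ℕ) (T′ : Tree) → size T′ ≡ d →
    (p : ℕ) → 2 ≤ p → p ≤ d →
    Σ Tree (λ T →
    (size T ≡ suc d
    × Special [2] p (postorder T)
    × erase (removeV p (postorder T)) ≡ T′)
    × ((T₂ : Tree) → size T₂ ≡ suc d →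
    Special [2] p (postorder T₂) →
    erase (removeV p (postorder T₂)) ≡ T′ → T₂ ≡ T)
    × ((τ : SpecialType) (q : ℕ) → 1 ≤ q → q ≤ p ∸ 1 →
    Special τ q (postorder T) ⇔ Special τ q (removeV p (postorder T))))
lemma3p10 d T′ refl p 2≤p@(s≤s _) p≤d =
  T , (size-T , special-T , removed-T) , unique , preserved
  where
    T : Tree
    T = insert p 0 T′
    special-T : Special [2] p (postorder T)
    special-T = insert-special p 0 T′ 2≤p p≤d
    removed-T : erase (removeV p (postorder T)) ≡ T′
    removed-T = remove-insert p 0 T′ 2≤p p≤d
    size-T : size T ≡ suc (size T′)
    size-T = trans (sym (size-remove 0 T special-T)) (cong (λ t → suc (size t)) removed-T)
    unique : (T₂ : Tree) → size T₂ ≡ suc (size T′) → Special [2] p (postorder T₂) →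
             erase (removeV p (postorder T₂)) ≡ T′ → T₂ ≡ T
    unique T₂ _ special₂ removed₂ =
      trans (sym (insert-remove p 0 T₂ special₂)) (cong (insert p 0) removed₂)
    preserved : (τ : SpecialType) (q : ℕ) → 1 ≤ q → q ≤ p ∸ 1 →
                Special τ q (postorder T) ⇔ Special τ q (removeV p (postorder T))
    preserved τ q _ q≤p-1 = remove-preserves 0 T special-T (s≤s q≤p-1)
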